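{- Let $n$, $2s$, $\delta$, $r_1$, $r_2$ be positive integers with $n\ge 2s+1\ge 5$, and let $r=r_1+r_2$. For positive integers $t\le s$ define $$g(t)= \binom{2s-t}{r}\binom{r}{r_{1}} +\sum_{j=1}^{2}\binom{t}{r_{j}}\left[\binom{n-r_{j}-1}{r-r_{j}}-\binom{2s-t-r_{j}}{r-r_{j}}\right]+\sum_{j=1}^{2}\binom{\delta}{r_{j}}\binom{n-r_j-1}{r-r_{j}-1}.$$ Then $g$ is a convex function of $t$, i.e. $g(t-1)+g(t+1)\ge 2g(t)$ for every integer $t$ with $t-1\ge 1$ and $t+1\le s$.
   Context: Binomial coefficients follow the combinatorial convention: for integers $a$ and $b$, $\binom{a}{b}$ is the number of $b$-element subsets of an $a$-element set when $0\le b\le a$, and $\binom{a}{b}=0$ otherwise. (In the paper, $g(t)$ equals $c$ times the number of copies of $K_{r_1,r_2}$ in a certain extremal graph, with $c=1$ if $r_1\ne r_2$ and $c=2$ if $r_1=r_2$.) -}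

module Defs where

open import Data.Nat using (ℕ; _*_)
open import Data.Nat.Combinatorics using (_C_)
open import Data.Integer using (ℤ; +_; -[1+_]) renaming (_+_ to _+ℤ_; _-_ to _-ℤ_; _*_ to _*ℤ_)

-- Combinatorial binomial coefficient on integers:
-- binom a b = number of b-subsets of an a-set if 0 ≤ b ≤ a, and 0 otherwise.
-- (stdlib's n C k already returns 0 when k > n.)
binom : ℤ → ℤ → ℤ
binom (+ a) (+ b) = + (a C b)
binom (+ a) -[1+ b ] = + 0
binom -[1+ a ] b = + 0

g : (n s δ r₁ r₂ : ℕ) → ℤ → ℤ
g n s δ r₁ r₂ t =
  binom (+ (2 * s) -ℤ t) r *ℤ binom r R₁
  +ℤ (term R₁ +ℤ term R₂)
  +ℤ (dterm R₁ +ℤ dterm R₂)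
  where
    R₁ = + r₁
    R₂ = + r₂
    r = R₁ +ℤ R₂
    N = + n
    term : ℤ → ℤ
    term rj = binom t rj *ℤ (binom (N -ℤ rj -ℤ + 1) (r -ℤ rj) -ℤ binom (+ (2 * s) -ℤ t -ℤ rj) (r -ℤ rj))
    dterm : ℤ → ℤ
    dterm rj = binom (+ δ) rj *ℤ binom (N -ℤ rj -ℤ + 1) (r -ℤ rj -ℤ + 1)

-- Write Δ²f(t) = f(t-1) + f(t+1) - 2f(t), and p = 2s - t - 1 ≥ t - 1, so that 2s - (t-1),
-- 2s - t and 2s - (t+1) are p + 2, p + 1 and p. The δ-terms of g do not depend on t, and by
-- Pascal's rule the leading term contributes C(p, r-2) C(r, r₁). The j-th summand is a product
-- u v with u = C(·, rⱼ) nonnegative, increasing and convex and v nonnegative and increasing, so the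
-- discrete Leibniz rule bounds its second difference below by
--   u(t-1) Δ²v(t) = -C(t-1, rⱼ) C(p-rⱼ, r-rⱼ-2) ≥ -C(p, rⱼ) C(p-rⱼ, r-rⱼ-2) = -C(p, r-2) C(r-2, rⱼ).
-- Hence Δ²g(t) ≥ C(p, r-2) (C(r, r₁) - C(r-2, r₁) - C(r-2, r₂)) ≥ 0, the last step because
-- C(r, r₁) = C(r-1, r₂) + C(r-1, r₁) by symmetry and Pascal's rule.
module Submission where

open import Defs

module Binomial where
  open import Data.Nat
  open import Data.Nat.Properties
  open import Data.Nat.Combinatorics
  open import Data.Nat.DivMod using (m/n*n≡m)
  open import Data.Nat.Tactic.RingSolver using (solve-∀)
  open import Data.Product using (Σ; _,_; _×_)
  open import Relation.Binary.PropositionalEquality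
  open import Relation.Nullary using (yes; no)

  pascal : ∀ n k → suc n C suc k ≡ n C k + n C suc k
  pascal n k = sym (nCk+nC[k+1]≡[n+1]C[k+1] n k)

  nCk≤[1+n]Ck : ∀ n k → n C k ≤ suc n C k
  nCk≤[1+n]Ck n zero    = ≤-refl
  nCk≤[1+n]Ck n (suc k) = subst (n C suc k ≤_) (sym (pascal n k)) (m≤n+m (n C suc k) (n C k))

  C-monoˡ-≤ : ∀ {m n} k → m ≤ n → m C k ≤ n C k
  C-monoˡ-≤ k m≤n = go (≤⇒≤′ m≤n)
    where
    go : ∀ {m n} → m ≤′ n → m C k ≤ n C k
    go ≤′-refl        = ≤-refl
    go (≤′-step m≤′n) = ≤-trans (go m≤′n) (nCk≤[1+n]Ck _ k)

  nCk*k!*[n∸k]!≡n! : ∀ {n k} → k ≤ n → (n C k) * (k ! * (n ∸ k) !) ≡ n !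
  nCk*k!*[n∸k]!≡n! {n} {k} k≤n =
    trans (cong (_* (k ! * (n ∸ k) !)) (nCk≡n!/k![n-k]! k≤n)) (m/n*n≡m (k![n∸k]!∣n! k≤n))
    where instance _ = k !* (n ∸ k) !≢0

  -- Both sides are n! / (a! c! (n - a - c)!), or 0 when a + c > n.
  nCa*[n∸a]Cc≡nC[a+c]*[a+c]Ca : ∀ n a c → (n C a) * ((n ∸ a) C c) ≡ (n C (a + c)) * ((a + c) C a)
  nCa*[n∸a]Cc≡nC[a+c]*[a+c]Ca n a c with a + c ≤? n
  ... | yes a+c≤n = *-cancelʳ-≡ _ _ D (trans lhs (sym rhs))
    where
    a≤n : a ≤ n
    a≤n = ≤-trans (m≤m+n a c) a+c≤n
    c≤n∸a : c ≤ n ∸ a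
    c≤n∸a = m+n≤o⇒m≤o∸n c (subst (_≤ n) (+-comm a c) a+c≤n)
    D = a ! * (c ! * (n ∸ a ∸ c) !)
    instance
      _ : NonZero D
      _ = m*n≢0 (a !) (c ! * (n ∸ a ∸ c) !) {{a !≢0}} {{m*n≢0 (c !) _ {{c !≢0}} {{(n ∸ a ∸ c) !≢0}}}}
    lhs : (n C a) * ((n ∸ a) C c) * D ≡ n !
    lhs = begin
      (n C a) * ((n ∸ a) C c) * (a ! * (c ! * (n ∸ a ∸ c) !))
        ≡⟨ regroup (n C a) ((n ∸ a) C c) (a !) (c !) ((n ∸ a ∸ c) !) ⟩
      (n C a) * (a ! * (((n ∸ a) C c) * (c ! * (n ∸ a ∸ c) !)))
        ≡⟨ cong (λ z → (n C a) * (a ! * z)) (nCk*k!*[n∸k]!≡n! c≤n∸a) ⟩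
      (n C a) * (a ! * (n ∸ a) !)
        ≡⟨ nCk*k!*[n∸k]!≡n! a≤n ⟩
      n ! ∎
      where
      open ≡-Reasoning
      regroup : ∀ x y u v w → x * y * (u * (v * w)) ≡ x * (u * (y * (v * w)))
      regroup = solve-∀
    rhs : (n C (a + c)) * ((a + c) C a) * D ≡ n !
    rhs = begin
      (n C (a + c)) * ((a + c) C a) * (a ! * (c ! * (n ∸ a ∸ c) !))
        ≡⟨ regroup (n C (a + c)) ((a + c) C a) (a !) (c !) ((n ∸ a ∸ c) !) ⟩
      (n C (a + c)) * (((a + c) C a) * (a ! * c !) * (n ∸ a ∸ c) !)
        ≡⟨ cong₂ (λ u v → (n C (a + c)) * (((a + c) C a) * (a ! * u !) * v !)) (sym (m+n∸m≡n a c)) (∸-+-assoc n a c) ⟩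
      (n C (a + c)) * (((a + c) C a) * (a ! * (a + c ∸ a) !) * (n ∸ (a + c)) !)
        ≡⟨ cong (λ z → (n C (a + c)) * (z * (n ∸ (a + c)) !)) (nCk*k!*[n∸k]!≡n! (m≤m+n a c)) ⟩
      (n C (a + c)) * ((a + c) ! * (n ∸ (a + c)) !)
        ≡⟨ nCk*k!*[n∸k]!≡n! a+c≤n ⟩
      n ! ∎
      where
      open ≡-Reasoning
      regroup : ∀ x y u v w → x * y * (u * (v * w)) ≡ x * ((y * (u * v)) * w)
      regroup = solve-∀
  ... | no a+c≰n = trans lhs≡0 (sym (cong (_* ((a + c) C a)) (k>n⇒nCk≡0 (≰⇒> a+c≰n))))
    where
    lhs≡0 : (n C a) * ((n ∸ a) C c) ≡ 0
    lhs≡0 with a ≤? n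
    ... | yes a≤n = trans (cong ((n C a) *_) (k>n⇒nCk≡0 (≰⇒> c≰n∸a))) (*-zeroʳ (n C a))
      where
      c≰n∸a : c ≰ n ∸ a
      c≰n∸a c≤n∸a = a+c≰n (subst (_≤ n) (+-comm c a) (subst (c + a ≤_) (m∸n+n≡m a≤n) (+-monoˡ-≤ a c≤n∸a)))
    ... | no a≰n = cong (_* ((n ∸ a) C c)) (k>n⇒nCk≡0 (≰⇒> a≰n))

  xCa*qCc≤pC[a+c]*[a+c]Ca : ∀ {x q p} a c → x ≤ p → q + a ≤ p →
    (x C a) * (q C c) ≤ (p C (a + c)) * ((a + c) C a)
  xCa*qCc≤pC[a+c]*[a+c]Ca {x} {q} {p} a c x≤p q+a≤p = begin
    (x C a) * (q C c)             ≤⟨ *-mono-≤ (C-monoˡ-≤ a x≤p) (C-monoˡ-≤ c q≤p∸a) ⟩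
    (p C a) * ((p ∸ a) C c)       ≡⟨ nCa*[n∸a]Cc≡nC[a+c]*[a+c]Ca p a c ⟩
    (p C (a + c)) * ((a + c) C a) ∎
    where
    open ≤-Reasoning
    q≤p∸a = m+n≤o⇒m≤o∸n q q+a≤p

  [α+β]C[1+α]+[α+β]C[1+β]≤[2+α+β]C[1+α] : ∀ α β →
    (α + β) C suc α + (α + β) C suc β ≤ (suc α + suc β) C suc α
  [α+β]C[1+α]+[α+β]C[1+β]≤[2+α+β]C[1+α] α β = begin
    m C suc α + m C suc β         ≡⟨ +-comm (m C suc α) (m C suc β) ⟩
    m C suc β + m C suc α         ≤⟨ +-mono-≤ (nCk≤[1+n]Ck m (suc β)) (nCk≤[1+n]Ck m (suc α)) ⟩
    suc m C suc β + suc m C suc α ≡⟨ cong (_+ suc m C suc α) symmetry ⟩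
    suc m C α + suc m C suc α     ≡⟨ sym (pascal (suc m) α) ⟩
    suc (suc m) C suc α           ≡⟨ cong (λ k → suc k C suc α) (sym (+-suc α β)) ⟩
    (suc α + suc β) C suc α       ∎
    where
    open ≤-Reasoning
    m = α + β
    symmetry : suc m C suc β ≡ suc m C α
    symmetry = trans (nCk≡nC[n∸k] (s≤s (m≤n+m β α)))
                     (cong (suc m C_) (trans (cong (_∸ suc β) (sym (+-suc α β))) (m+n∸n≡m α (suc β))))

  x+2≤s⇒∃[p]2s≡[1+x]+[1+p]×x≤p : ∀ {x s} → suc x + 1 ≤ s → Σ ℕ λ p → 2 * s ≡ suc x + suc p × x ≤ p
  x+2≤s⇒∃[p]2s≡[1+x]+[1+p]×x≤p {x} x+2≤s with m≤n⇒∃[o]m+o≡n x+2≤s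
  ... | k , refl = x + (2 + 2 * k) , identity x k , m≤m+n x _
    where
    identity : ∀ x k → 2 * (suc x + 1 + k) ≡ suc x + suc (x + (2 + 2 * k))
    identity = solve-∀

module SecondDifference where
  open import Data.Nat using (z≤n)
  open import Data.Integer
  open import Data.Integer.Properties
  open import Data.Integer.Tactic.RingSolver using (solve-∀)
  open import Relation.Binary.PropositionalEquality

  Δ² : (ℤ → ℤ) → ℤ → ℤ
  Δ² f t = f (t - 1ℤ) + f (t + 1ℤ) - + 2 * f t

  Δ²-+ : ∀ f h t → Δ² (λ u → f u + h u) t ≡ Δ² f t + Δ² h t
  Δ²-+ f h t = identity (f (t - 1ℤ)) (f (t + 1ℤ)) (f t) (h (t - 1ℤ)) (h (t + 1ℤ)) (h t)
    where
    identity : ∀ a b c a′ b′ c′ →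
      (a + a′) + (b + b′) - + 2 * (c + c′) ≡ (a + b - + 2 * c) + (a′ + b′ - + 2 * c′)
    identity = solve-∀

  Δ²-+-const : ∀ f k t → Δ² (λ u → f u + k) t ≡ Δ² f t
  Δ²-+-const f k t = identity (f (t - 1ℤ)) (f (t + 1ℤ)) (f t) k
    where
    identity : ∀ a b c k → (a + k) + (b + k) - + 2 * (c + k) ≡ a + b - + 2 * c
    identity = solve-∀

  Δ²-*-const : ∀ f k t → Δ² (λ u → f u * k) t ≡ Δ² f t * k
  Δ²-*-const f k t = identity (f (t - 1ℤ)) (f (t + 1ℤ)) (f t) k
    where
    identity : ∀ a b c k → a * k + b * k - + 2 * (c * k) ≡ (a + b - + 2 * c) * k
    identity = solve-∀

  Δ²-const-minus : ∀ k f t → Δ² (λ u → k - f u) t ≡ - Δ² f t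
  Δ²-const-minus k f t = identity (f (t - 1ℤ)) (f (t + 1ℤ)) (f t) k
    where
    identity : ∀ a b c k → (k - a) + (k - b) - + 2 * (k - c) ≡ - (a + b - + 2 * c)
    identity = solve-∀

  Δ²-reflect : ∀ f c t → Δ² (λ u → f (c - u)) t ≡ Δ² f (c - t)
  Δ²-reflect f c t = begin
    f (c - (t - 1ℤ)) + f (c - (t + 1ℤ)) - + 2 * f (c - t)
      ≡⟨ cong₂ (λ u v → f u + f v - + 2 * f (c - t)) (step⁺ c t) (step⁻ c t) ⟩
    f (c - t + 1ℤ) + f (c - t - 1ℤ) - + 2 * f (c - t)
      ≡⟨ cong (_- + 2 * f (c - t)) (+-comm (f (c - t + 1ℤ)) (f (c - t - 1ℤ))) ⟩
    Δ² f (c - t) ∎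
    where
    open ≡-Reasoning
    step⁺ : ∀ c t → c - (t - 1ℤ) ≡ c - t + 1ℤ
    step⁺ = solve-∀
    step⁻ : ∀ c t → c - (t + 1ℤ) ≡ c - t - 1ℤ
    step⁻ = solve-∀

  Δ²-shift : ∀ f d t → Δ² (λ u → f (u - d)) t ≡ Δ² f (t - d)
  Δ²-shift f d t = cong₂ (λ u v → f u + f v - + 2 * f (t - d)) (step⁻ d t) (step⁺ d t)
    where
    step⁻ : ∀ d t → t - 1ℤ - d ≡ t - d - 1ℤ
    step⁻ = solve-∀
    step⁺ : ∀ d t → t + 1ℤ - d ≡ t - d + 1ℤ
    step⁺ = solve-∀

  Δ²-* : ∀ f h t → Δ² (λ u → f u * h u) t ≡
    f (t - 1ℤ) * Δ² h t + (+ 2 * ((f t - f (t - 1ℤ)) * (h (t + 1ℤ) - h t)) + Δ² f t * h (t + 1ℤ))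
  Δ²-* f h t = identity (f (t - 1ℤ)) (f (t + 1ℤ)) (f t) (h (t - 1ℤ)) (h (t + 1ℤ)) (h t)
    where
    identity : ∀ a b c a′ b′ c′ → a * a′ + b * b′ - + 2 * (c * c′) ≡
      a * (a′ + b′ - + 2 * c′) + (+ 2 * ((c - a) * (b′ - c′)) + (a + b - + 2 * c) * b′)
    identity = solve-∀

  *-nonNeg : ∀ {i j} → 0ℤ ≤ i → 0ℤ ≤ j → 0ℤ ≤ i * j
  *-nonNeg {+ m} {+ n} _ _ = subst (0ℤ ≤_) (pos-* m n) (+≤+ z≤n)

  Δ²-*-≥ : ∀ f h t → 0ℤ ≤ f (t - 1ℤ) → 0ℤ ≤ f t - f (t - 1ℤ) → 0ℤ ≤ Δ² f t →
    0ℤ ≤ h (t + 1ℤ) - h t → 0ℤ ≤ h (t + 1ℤ) → f (t - 1ℤ) * Δ² h t ≤ Δ² (λ u → f u * h u) t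
  Δ²-*-≥ f h t f₀ Δf Δ²f Δh h₂ = ≤-trans
    (i≤i+j _ _ {{nonNegative (+-mono-≤ (*-nonNeg {+ 2} (+≤+ z≤n) (*-nonNeg Δf Δh)) (*-nonNeg Δ²f h₂))}})
    (≤-reflexive (sym (Δ²-* f h t)))

  Δ²-nonNeg⇒convex : ∀ f t → 0ℤ ≤ Δ² f t → + 2 * f t ≤ f (t - 1ℤ) + f (t + 1ℤ)
  Δ²-nonNeg⇒convex f t = 0≤i-j⇒j≤i

module IntegerBinomial where
  open import Data.Nat as ℕ using (zero; suc; z≤n)
  import Data.Nat.Properties as ℕ
  open import Data.Nat.Combinatorics using (_C_; k>n⇒nCk≡0)
  open import Data.Integer hiding (suc)
  open import Data.Integer.Properties
  open import Data.Integer.Tactic.RingSolver using (solve-∀)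
  open import Relation.Binary.PropositionalEquality
  open import Relation.Nullary using (yes; no)
  open Binomial using (pascal; C-monoˡ-≤; xCa*qCc≤pC[a+c]*[a+c]Ca)
  open SecondDifference using (Δ²)

  binom-nonNeg : ∀ u k → 0ℤ ≤ binom u k
  binom-nonNeg (+ _)    (+ _)    = +≤+ z≤n
  binom-nonNeg (+ _)    -[1+ _ ] = +≤+ z≤n
  binom-nonNeg -[1+ _ ] _        = +≤+ z≤n

  binom-monoˡ-≤ : ∀ k {u v} → u ≤ v → binom u k ≤ binom v k
  binom-monoˡ-≤ k        { -[1+ _ ]} {v} _ = binom-nonNeg v k
  binom-monoˡ-≤ (+ k)    (+≤+ m≤n) = +≤+ (C-monoˡ-≤ k m≤n)
  binom-monoˡ-≤ -[1+ _ ] (+≤+ _)   = ≤-refl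

  Δ²-binom-suc : ∀ q j → Δ² (λ u → binom u (+ suc j)) (+ suc q) ≡ + (suc q C j) - + (q C j)
  Δ²-binom-suc q j rewrite ℕ.+-comm q 1 | pascal (suc q) j | pascal q j =
    identity (+ (q C j)) (+ (q C suc j)) (+ (suc q C j))
    where
    identity : ∀ a b d → b + (d + (a + b)) - + 2 * (a + b) ≡ d - a
    identity = solve-∀

  Δ²-binom-suc-suc : ∀ q j → Δ² (λ u → binom u (+ suc (suc j))) (+ suc q) ≡ + (q C j)
  Δ²-binom-suc-suc q j rewrite Δ²-binom-suc q (suc j) | pascal q j = identity (+ (q C j)) (+ (q C suc j))
    where
    identity : ∀ a b → a + b - b ≡ a
    identity = solve-∀

  weighted-Δ²-binom-≤ : ∀ x p q α β → x ℕ.≤ p → q ℕ.+ suc α ℕ.≤ p →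
    + (x C suc α) * Δ² (λ u → binom u (+ suc β)) (+ suc q)
      ≤ + ((p C (α ℕ.+ β)) ℕ.* ((α ℕ.+ β) C suc α))
  weighted-Δ²-binom-≤ x p q α zero _ _ rewrite Δ²-binom-suc q 0 =
    ≤-trans (≤-reflexive (*-zeroʳ (+ (x C suc α)))) (+≤+ z≤n)
  weighted-Δ²-binom-≤ x p q α (suc γ) x≤p q+a≤p rewrite Δ²-binom-suc-suc q γ | ℕ.+-suc α γ =
    ≤-trans (≤-reflexive (sym (pos-* (x C suc α) (q C γ)))) (+≤+ (xCa*qCc≤pC[a+c]*[a+c]Ca (suc α) γ x≤p q+a≤p))

  weighted-Δ²-binom-at-difference-≤ : ∀ x p α β → x ℕ.≤ p →
    + (x C suc α) * Δ² (λ u → binom u (+ suc β)) (+ suc p - + suc α)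
      ≤ + ((p C (α ℕ.+ β)) ℕ.* ((α ℕ.+ β) C suc α))
  weighted-Δ²-binom-at-difference-≤ x p α β x≤p with suc α ℕ.≤? p
  ... | no a≰p rewrite k>n⇒nCk≡0 (ℕ.≤-<-trans x≤p (ℕ.≰⇒> a≰p)) =
    ≤-trans (≤-reflexive (*-zeroˡ (Δ² (λ u → binom u (+ suc β)) (+ suc p - + suc α)))) (+≤+ z≤n)
  ... | yes a≤p =
    subst (λ v → + (x C suc α) * Δ² (λ u → binom u (+ suc β)) v ≤ + ((p C (α ℕ.+ β)) ℕ.* ((α ℕ.+ β) C suc α)))
          (sym shift)
          (weighted-Δ²-binom-≤ x p q α β x≤p (ℕ.≤-reflexive (ℕ.m∸n+n≡m a≤p)))
    where
    q = p ℕ.∸ suc α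
    shift : + suc p - + suc α ≡ + suc q
    shift = trans (m-n≡m⊖n (suc p) (suc α)) (trans (⊖-≥ (ℕ.m≤n⇒m≤1+n a≤p)) (cong +_ (ℕ.+-∸-assoc 1 a≤p)))

module SecondDifferenceOfG where
  open import Data.Nat as ℕ using (ℕ; suc; z≤n)
  import Data.Nat.Properties as ℕ
  open import Data.Nat.Combinatorics using (_C_)
  open import Data.Integer hiding (suc)
  open import Data.Integer.Properties
  open import Data.Integer.Tactic.RingSolver using (solve-∀)
  open import Data.Product using (Σ; _,_)
  open import Relation.Binary.PropositionalEquality
  open Binomial using (nCk≤[1+n]Ck; [α+β]C[1+α]+[α+β]C[1+β]≤[2+α+β]C[1+α])
  open SecondDifference
  open IntegerBinomial

  j-i≡+k⇒i≤j : ∀ {i j} k → j - i ≡ + k → i ≤ j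
  j-i≡+k⇒i≤j k eq = 0≤i-j⇒j≤i (subst (0ℤ ≤_) (sym eq) (+≤+ z≤n))

  [a+b]-a≡b : ∀ a b → (a + b) - a ≡ b
  [a+b]-a≡b = solve-∀

  [a+b]-b≡a : ∀ a b → (a + b) - b ≡ a
  [a+b]-b≡a = solve-∀

  m≡a+b⇒+m-+a≡+b : ∀ {m} a b → m ≡ a ℕ.+ b → + m - + a ≡ + b
  m≡a+b⇒+m-+a≡+b a b refl = [a+b]-a≡b (+ a) (+ b)

  summand : ℕ → ℕ → ℤ → ℤ → ℤ → ℤ
  summand n s a c t = binom t a * (binom (+ n - a - 1ℤ) c - binom (+ (2 ℕ.* s) - t - a) c)

  leading-term : ℕ → ℕ → ℕ → ℤ → ℤ
  leading-term s a b t = binom (+ (2 ℕ.* s) - t) (+ (a ℕ.+ b)) * + ((a ℕ.+ b) C a)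

  Δ²-leading-term : ∀ s x p α β → 2 ℕ.* s ≡ suc x ℕ.+ suc p →
    Δ² (leading-term s (suc α) (suc β)) (+ suc x) ≡ + ((p C (α ℕ.+ β)) ℕ.* ((suc α ℕ.+ suc β) C suc α))
  Δ²-leading-term s x p α β 2s≡ = begin
    Δ² (λ u → binom (S - u) r * c) t       ≡⟨ Δ²-*-const (λ u → binom (S - u) r) c t ⟩
    Δ² (λ u → binom (S - u) r) t * c       ≡⟨ cong (_* c) (Δ²-reflect (λ v → binom v r) S t) ⟩
    Δ² (λ v → binom v r) (S - t) * c       ≡⟨ cong (λ v → Δ² (λ u → binom u r) v * c) (m≡a+b⇒+m-+a≡+b (suc x) (suc p) 2s≡) ⟩
    Δ² (λ v → binom v r) (+ suc p) * c     ≡⟨ cong (_* c) Δ²-binom-r ⟩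
    + (p C (α ℕ.+ β)) * c                  ≡⟨ sym (pos-* (p C (α ℕ.+ β)) _) ⟩
    + ((p C (α ℕ.+ β)) ℕ.* ((suc α ℕ.+ suc β) C suc α)) ∎
    where
    open ≡-Reasoning
    S = + (2 ℕ.* s)
    t = + suc x
    r = + (suc α ℕ.+ suc β)
    c = + ((suc α ℕ.+ suc β) C suc α)
    Δ²-binom-r : Δ² (λ v → binom v r) (+ suc p) ≡ + (p C (α ℕ.+ β))
    Δ²-binom-r = trans (cong (λ k → Δ² (λ v → binom v (+ suc k)) (+ suc p)) (ℕ.+-suc α β))
                       (Δ²-binom-suc-suc p (α ℕ.+ β))

  Δ²-summand-≥ : ∀ n s x p α β → 2 ℕ.* s ≡ suc x ℕ.+ suc p → x ℕ.≤ p → 2 ℕ.* s ℕ.+ 1 ℕ.≤ n →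
    - + ((p C (α ℕ.+ β)) ℕ.* ((α ℕ.+ β) C suc α)) ≤ Δ² (summand n s (+ suc α) (+ suc β)) (+ suc x)
  Δ²-summand-≥ n s x p α β 2s≡ x≤p 2s+1≤n = begin
    - + ((p C (α ℕ.+ β)) ℕ.* ((α ℕ.+ β) C suc α))
      ≤⟨ neg-mono-≤ (weighted-Δ²-binom-at-difference-≤ x p α β x≤p) ⟩
    - (f (t - 1ℤ) * Δ² B (+ suc p - a))
      ≡⟨ cong (λ v → - (f (t - 1ℤ) * Δ² B (v - a))) (sym S-t≡) ⟩
    - (f (t - 1ℤ) * Δ² B (S - t - a))
      ≡⟨ neg-distribʳ-* (f (t - 1ℤ)) _ ⟩
    f (t - 1ℤ) * - Δ² B (S - t - a)
      ≡⟨ cong (f (t - 1ℤ) *_) (sym Δ²h) ⟩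
    f (t - 1ℤ) * Δ² h t
      ≤⟨ Δ²-*-≥ f h t (binom-nonNeg (+ x) a) Δf Δ²f Δh h₂ ⟩
    Δ² (summand n s a c) t ∎
    where
    open ≤-Reasoning
    a = + suc α
    c = + suc β
    t = + suc x
    S = + (2 ℕ.* s)
    A = binom (+ n - a - 1ℤ) c
    B = λ u → binom u c
    f = λ u → binom u a
    h = λ u → A - B (S - u - a)
    S-t≡ : S - t ≡ + suc p
    S-t≡ = m≡a+b⇒+m-+a≡+b (suc x) (suc p) 2s≡
    Δ²h : Δ² h t ≡ - Δ² B (S - t - a)
    Δ²h = trans (Δ²-const-minus A (λ u → B (S - u - a)) t)
                (cong -_ (trans (Δ²-reflect (λ v → B (v - a)) S t) (Δ²-shift B a (S - t))))
    Δf : 0ℤ ≤ f t - f (t - 1ℤ)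
    Δf = i≤j⇒0≤j-i (binom-monoˡ-≤ a (+≤+ (ℕ.n≤1+n x)))
    Δ²f : 0ℤ ≤ Δ² f t
    Δ²f = subst (0ℤ ≤_) (sym (Δ²-binom-suc x α)) (i≤j⇒0≤j-i (+≤+ (nCk≤[1+n]Ck x α)))
    Δh : 0ℤ ≤ h (t + 1ℤ) - h t
    Δh = subst (0ℤ ≤_) (identity A (B (S - t - a)) (B (S - (t + 1ℤ) - a)))
           (i≤j⇒0≤j-i (binom-monoˡ-≤ c {S - (t + 1ℤ) - a} {S - t - a} (j-i≡+k⇒i≤j 1 (step S t a))))
      where
      identity : ∀ A B₁ B₂ → B₁ - B₂ ≡ (A - B₂) - (A - B₁)
      identity = solve-∀
      step : ∀ S t a → (S - t - a) - (S - (t + 1ℤ) - a) ≡ 1ℤ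
      step = solve-∀
    h₂ : 0ℤ ≤ h (t + 1ℤ)
    h₂ = i≤j⇒0≤j-i (binom-monoˡ-≤ c (S-[t+1]-a≤n-a-1 (ℕ.m≤n⇒∃[o]m+o≡n 2s+1≤n)))
      where
      step : ∀ S k t a → (S + 1ℤ + k - a - 1ℤ) - (S - (t + 1ℤ) - a) ≡ k + t + 1ℤ
      step = solve-∀
      S-[t+1]-a≤n-a-1 : (Σ ℕ λ k → 2 ℕ.* s ℕ.+ 1 ℕ.+ k ≡ n) → S - (t + 1ℤ) - a ≤ + n - a - 1ℤ
      S-[t+1]-a≤n-a-1 (k , refl) = j-i≡+k⇒i≤j (k ℕ.+ suc x ℕ.+ 1) (step S (+ k) t a)

  Δ²-g : ∀ n s δ a b t → Δ² (g n s δ a b) t ≡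
    Δ² (leading-term s a b) t + (Δ² (summand n s (+ a) (+ b)) t + Δ² (summand n s (+ b) (+ a)) t)
  Δ²-g n s δ a b t = begin
    Δ² (g n s δ a b) t
      -- the δ-terms, constant in t, are inferred for the _
      ≡⟨ Δ²-+-const (λ u → leading-term s a b u + (summand n s A (R - A) u + summand n s B (R - B) u)) _ t ⟩
    Δ² (λ u → leading-term s a b u + (summand n s A (R - A) u + summand n s B (R - B) u)) t
      ≡⟨ cong₂ (λ c d → Δ² (λ u → leading-term s a b u + (summand n s A c u + summand n s B d u)) t)
               ([a+b]-a≡b A B) ([a+b]-b≡a A B) ⟩
    Δ² (λ u → leading-term s a b u + (summand n s A B u + summand n s B A u)) t
      ≡⟨ Δ²-+ (leading-term s a b) (λ u → summand n s A B u + summand n s B A u) t ⟩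
    Δ² (leading-term s a b) t + Δ² (λ u → summand n s A B u + summand n s B A u) t
      ≡⟨ cong (_+_ (Δ² (leading-term s a b) t)) (Δ²-+ (summand n s A B) (summand n s B A) t) ⟩
    Δ² (leading-term s a b) t + (Δ² (summand n s A B) t + Δ² (summand n s B A) t) ∎
    where
    open ≡-Reasoning
    A = + a
    B = + b
    R = A + B

  0≤Δ²g : ∀ n s δ α β x p → 2 ℕ.* s ≡ suc x ℕ.+ suc p → x ℕ.≤ p → 2 ℕ.* s ℕ.+ 1 ℕ.≤ n →
    0ℤ ≤ Δ² (g n s δ (suc α) (suc β)) (+ suc x)
  0≤Δ²g n s δ α β x p 2s≡ x≤p 2s+1≤n = begin
    0ℤ
      ≤⟨ i≤j⇒0≤j-i (+≤+ weights) ⟩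
    + (Y ℕ.* c) - (+ (Y ℕ.* c₁) + + (Y ℕ.* c₂))
      ≡⟨ identity (+ (Y ℕ.* c)) (+ (Y ℕ.* c₁)) (+ (Y ℕ.* c₂)) ⟩
    + (Y ℕ.* c) + (- + (Y ℕ.* c₁) + - + (Y ℕ.* c₂))
      ≤⟨ +-mono-≤ (≤-reflexive (sym (Δ²-leading-term s x p α β 2s≡)))
                  (+-mono-≤ (Δ²-summand-≥ n s x p α β 2s≡ x≤p 2s+1≤n) summand₂-≥) ⟩
    Δ² (leading-term s a b) t + (Δ² (summand n s (+ a) (+ b)) t + Δ² (summand n s (+ b) (+ a)) t)
      ≡⟨ sym (Δ²-g n s δ a b t) ⟩
    Δ² (g n s δ a b) t ∎
    where
    open ≤-Reasoning
    a = suc α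
    b = suc β
    t = + suc x
    m = α ℕ.+ β
    Y = p C m
    c = (a ℕ.+ b) C a
    c₁ = m C a
    c₂ = m C b
    weights : Y ℕ.* c₁ ℕ.+ Y ℕ.* c₂ ℕ.≤ Y ℕ.* c
    weights = ℕ.≤-trans (ℕ.≤-reflexive (sym (ℕ.*-distribˡ-+ Y c₁ c₂)))
                        (ℕ.*-monoʳ-≤ Y ([α+β]C[1+α]+[α+β]C[1+β]≤[2+α+β]C[1+α] α β))
    summand₂-≥ : - + (Y ℕ.* c₂) ≤ Δ² (summand n s (+ b) (+ a)) t
    summand₂-≥ = subst (λ k → - + ((p C k) ℕ.* (k C b)) ≤ Δ² (summand n s (+ b) (+ a)) t) (ℕ.+-comm β α)
                   (Δ²-summand-≥ n s x p β α 2s≡ x≤p 2s+1≤n)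
    identity : ∀ u v w → u - (v + w) ≡ u + (- v + - w)
    identity = solve-∀

open import Data.Nat using (ℕ; suc; _≤_; _+_; _*_; _∸_)
open import Data.Integer using (ℤ; +_) renaming (_+_ to _+ℤ_; _-_ to _-ℤ_; _*_ to _*ℤ_; _≤_ to _≤ℤ_)
open import Data.Product using (_,_)
open Binomial using (x+2≤s⇒∃[p]2s≡[1+x]+[1+p]×x≤p)
open SecondDifference using (Δ²-nonNeg⇒convex)
open SecondDifferenceOfG using (0≤Δ²g)

proposition2p8 : (n s δ r₁ r₂ : ℕ) → 1 ≤ n → 1 ≤ s → 1 ≤ δ → 1 ≤ r₁ → 1 ≤ r₂ →
    2 * s + 1 ≤ n → 5 ≤ 2 * s + 1 →
    (t : ℕ) → 1 ≤ t ∸ 1 → t + 1 ≤ s →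
    + 2 *ℤ g n s δ r₁ r₂ (+ t) ≤ℤ g n s δ r₁ r₂ (+ t -ℤ + 1) +ℤ g n s δ r₁ r₂ (+ t +ℤ + 1)
proposition2p8 n s δ (suc α) (suc β) _ _ _ _ _ 2s+1≤n _ (suc x) _ x+2≤s =
  let (p , 2s≡[1+x]+[1+p] , x≤p) = x+2≤s⇒∃[p]2s≡[1+x]+[1+p]×x≤p x+2≤s in
  Δ²-nonNeg⇒convex (g n s δ (suc α) (suc β)) (+ suc x) (0≤Δ²g n s δ α β x p 2s≡[1+x]+[1+p] x≤p 2s+1≤n)
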